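{- For all integers $a,b$ with $0\le a\le b$, $\mathcal{G}(0,a,b)=\mathcal{G}(0,b-a,b)$.
   Context: Three-pile Sharing Nim: a position is a triple of nonnegative integers (pile sizes; the order of the piles is irrelevant). A move consists of choosing a pile, taking some positive number $k$ of tokens from it and adding them to one of the other piles, provided that after the move the receiving pile does not have more tokens than the source pile. Thus from $(a,b,c)$ with $a\le b\le c$ the moves are to $(a+k,b-k,c)$ with $1\le k\le (b-a)/2$, to $(a+k,b,c-k)$ with $1\le k\le (c-a)/2$, and to $(a,b+k,c-k)$ with $1\le k\le (c-b)/2$. Normal play: the player who cannot move loses. $\operatorname{mex}(S)$ is the least nonnegative integer not in $S$, and the Sprague–Grundy value is $\mathcal{G}(p)=\operatorname{mex}\{\mathcal{G}(q): q \text{ reachable from } p \text{ in one move}\}$. -}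

module Defs where

open import Data.Nat using (ℕ; zero; suc; _+_; _*_; _∸_; _≤ᵇ_)
open import Data.Bool using (Bool; true; false; if_then_else_)
open import Data.List using (List; []; _∷_; map; _++_; concatMap; filter; upTo)
open import Data.Product using (_×_; _,_)
open import Data.List.Membership.DecPropositional (Data.Nat._≟_) using (_∈?_)
open import Relation.Nullary using (does)

Pos : Set
Pos = ℕ × ℕ × ℕ

-- Transfer moves of k ≥ 1 tokens from a source pile s to a receiving pile r
-- allowed iff r + k ≤ s ∸ k (equivalently r + 2k ≤ s).
transfers : ℕ → ℕ → List (ℕ × ℕ)
transfers s r =
  map (λ k → (s ∸ k , r + k))
      (filter (λ k → Data.Nat._≤?_ (r + (k + k)) s) (map suc (upTo s)))

moves : Pos → List Pos
moves (x , y , z) =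
     map (λ { (x' , y') → (x' , y' , z) }) (transfers x y)
  ++ map (λ { (x' , z') → (x' , y , z') }) (transfers x z)
  ++ map (λ { (y' , x') → (x' , y' , z) }) (transfers y x)
  ++ map (λ { (y' , z') → (x , y' , z') }) (transfers y z)
  ++ map (λ { (z' , x') → (x' , y , z') }) (transfers z x)
  ++ map (λ { (z' , y') → (x , y' , z') }) (transfers z y)

-- mex: least natural number not in the list (search bounded by length suffices;
-- we search from 0 with fuel = length + 1).
mexFrom : ℕ → ℕ → List ℕ → ℕ
mexFrom zero i l = i
mexFrom (suc f) i l = if does (i ∈? l) then mexFrom f (suc i) l else i

mex : List ℕ → ℕ
mex l = mexFrom (suc (Data.List.length l)) 0 l

-- Each move strictly decreases x²+y²+z²
-- (it is also at least 0), so fuel x²+y²+z²+1 suffices for the recursion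
-- to bottom out exactly like the true recursive definition.
grundyFuel : ℕ → Pos → ℕ
grundyFuel zero p = 0
grundyFuel (suc f) p = mex (map (grundyFuel f) (moves p))

measure : Pos → ℕ
measure (x , y , z) = x * x + y * y + z * z

G : Pos → ℕ
G p = grundyFuel (suc (measure p)) p

module Submission where

-- The complement (x , y , z) ↦ (M ∸ z , M ∸ y , M ∸ x) is an involution of the
-- positions whose piles are all at most M, and it carries moves to moves: moving
-- k tokens from s onto r becomes moving k tokens from M ∸ r onto M ∸ s, and the
-- legality condition r + k ≤ s ∸ k is self-dual. So it preserves Grundy values,
-- and for M = b it sends (0 , a , b) to (0 , b ∸ a , b).

open import Defs
open import Data.Empty using (⊥-elim)
open import Data.List using (List; []; _∷_; map; _++_; filter; upTo; length)
open import Data.List.Membership.Propositional using (_∈_; _∉_)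
open import Data.List.Membership.Propositional.Properties
open import Data.List.Properties using (length-++; map-cong-local)
open import Data.List.Relation.Binary.Subset.Propositional using (_⊆_)
import Data.List.Relation.Unary.All as All
open import Data.List.Relation.Unary.Any using (here; there)
open import Data.Nat using (ℕ; zero; suc; _+_; _*_; _∸_; _≤_; _<_; _≤?_; z≤n; s≤s)
open import Data.Nat.Properties
open import Algebra.Properties.CommutativeSemigroup +-commutativeSemigroup using (xy∙z≈xz∙y)
open import Data.List.Membership.DecPropositional _≟_ using (_∈?_)
open import Data.Nat.Tactic.RingSolver using (solve; solve-∀)
open import Data.Product using (_×_; _,_; ∃; ∃₂)
open import Data.Sum using (_⊎_; inj₁; inj₂; [_,_]′)
open import Function using (_∘_)
open import Relation.Binary.Definitions using (tri<; tri≈; tri>)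
open import Relation.Binary.PropositionalEquality
open import Relation.Nullary using (yes; no)

-- Transfer s r s′ r′: moving suc k tokens from a pile s onto a pile r leaves
-- piles s′ and r′, where d = s′ ∸ r′ is the slack left to the source.
data Transfer : ℕ → ℕ → ℕ → ℕ → Set where
  transfer : ∀ r k d → Transfer (r + suc k + d + suc k) r (r + suc k + d) (r + suc k)

+-double-regroup : ∀ r k d → r + (k + k) + d ≡ r + k + d + k
+-double-regroup = solve-∀

transfer-of : ∀ {s r} k → r + (suc k + suc k) ≤ s → Transfer s r (s ∸ suc k) (r + suc k)
transfer-of {s} {r} k r+2k≤s = from-gap (m≤n⇒∃[o]m+o≡n r+2k≤s)
  where
  from-gap : ∃ (λ d → r + (suc k + suc k) + d ≡ s) → Transfer s r (s ∸ suc k) (r + suc k)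
  from-gap (d , refl)
    rewrite +-double-regroup r (suc k) d | m+n∸n≡m (r + suc k + d) (suc k) = transfer r k d

∈-transfers⁻ : ∀ {s r q} → q ∈ transfers s r → ∃₂ λ s′ r′ → q ≡ (s′ , r′) × Transfer s r s′ r′
∈-transfers⁻ {s} {r} q∈ with k , k∈ , refl ← ∈-map⁻ _ q∈
  with k∈1…s , r+2k≤s ← ∈-filter⁻ (λ k → r + (k + k) ≤? s) {xs = map suc (upTo s)} k∈
  with j , _ , refl ← ∈-map⁻ suc k∈1…s
  = _ , _ , refl , transfer-of j r+2k≤s

∈-transfers⁺ : ∀ {s r s′ r′} → Transfer s r s′ r′ → (s′ , r′) ∈ transfers s r
∈-transfers⁺ (transfer r k d) =
  subst (λ s′ → (s′ , r + suc k) ∈ transfers s r) (m+n∸n≡m (r + suc k + d) (suc k))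
    (∈-map⁺ _ (∈-filter⁺ (λ k → r + (k + k) ≤? s) k∈1…s r+2k≤s))
  where
  s : ℕ
  s = r + suc k + d + suc k
  r+2k≤s : r + (suc k + suc k) ≤ s
  r+2k≤s = subst (r + (suc k + suc k) ≤_) (+-double-regroup r (suc k) d)
             (m≤m+n (r + (suc k + suc k)) d)
  k∈1…s : suc k ∈ map suc (upTo s)
  k∈1…s = ∈-map⁺ suc (∈-upTo⁺ (m+n≤o⇒n≤o (r + suc k + d) ≤-refl))

data Move : Pos → Pos → Set where
  x→y : ∀ {x y z x′ y′} → Transfer x y x′ y′ → Move (x , y , z) (x′ , y′ , z)
  x→z : ∀ {x y z x′ z′} → Transfer x z x′ z′ → Move (x , y , z) (x′ , y , z′)
  y→x : ∀ {x y z x′ y′} → Transfer y x y′ x′ → Move (x , y , z) (x′ , y′ , z)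
  y→z : ∀ {x y z y′ z′} → Transfer y z y′ z′ → Move (x , y , z) (x , y′ , z′)
  z→x : ∀ {x y z x′ z′} → Transfer z x z′ x′ → Move (x , y , z) (x′ , y , z′)
  z→y : ∀ {x y z y′ z′} → Transfer z y z′ y′ → Move (x , y , z) (x , y′ , z′)

∈-map-transfers⁻ : ∀ {s r p q} {f : ℕ × ℕ → Pos} →
                   (∀ {s′ r′} → Transfer s r s′ r′ → Move p (f (s′ , r′))) →
                   q ∈ map f (transfers s r) → Move p q
∈-map-transfers⁻ move q∈ with (s′ , r′) , sr∈ , refl ← ∈-map⁻ _ q∈
  with _ , _ , refl , t ← ∈-transfers⁻ sr∈ = move t

∈-moves⁻ : ∀ {p q} → q ∈ moves p → Move p q
∈-moves⁻ {x , y , z} =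
  [ ∈-map-transfers⁻ x→y , [ ∈-map-transfers⁻ x→z , [ ∈-map-transfers⁻ y→x ,
  [ ∈-map-transfers⁻ y→z , [ ∈-map-transfers⁻ z→x , ∈-map-transfers⁻ z→y ]′
    ∘ ∈-++⁻ (map _ (transfers z x)) ]′
    ∘ ∈-++⁻ (map _ (transfers y z)) ]′
    ∘ ∈-++⁻ (map _ (transfers y x)) ]′
    ∘ ∈-++⁻ (map _ (transfers x z)) ]′
    ∘ ∈-++⁻ (map _ (transfers x y))

∈-moves⁺ : ∀ {p q} → Move p q → q ∈ moves p
∈-moves⁺ {x , y , z} (x→y t) =
  ∈-++⁺ˡ (∈-map⁺ _ (∈-transfers⁺ t))
∈-moves⁺ {x , y , z} (x→z t) =
  ∈-++⁺ʳ (map _ (transfers x y)) (∈-++⁺ˡ (∈-map⁺ _ (∈-transfers⁺ t)))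
∈-moves⁺ {x , y , z} (y→x t) =
  ∈-++⁺ʳ (map _ (transfers x y)) (∈-++⁺ʳ (map _ (transfers x z))
  (∈-++⁺ˡ (∈-map⁺ _ (∈-transfers⁺ t))))
∈-moves⁺ {x , y , z} (y→z t) =
  ∈-++⁺ʳ (map _ (transfers x y)) (∈-++⁺ʳ (map _ (transfers x z))
  (∈-++⁺ʳ (map _ (transfers y x)) (∈-++⁺ˡ (∈-map⁺ _ (∈-transfers⁺ t)))))
∈-moves⁺ {x , y , z} (z→x t) =
  ∈-++⁺ʳ (map _ (transfers x y)) (∈-++⁺ʳ (map _ (transfers x z))
  (∈-++⁺ʳ (map _ (transfers y x)) (∈-++⁺ʳ (map _ (transfers y z))
  (∈-++⁺ˡ (∈-map⁺ _ (∈-transfers⁺ t))))))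
∈-moves⁺ {x , y , z} (z→y t) =
  ∈-++⁺ʳ (map _ (transfers x y)) (∈-++⁺ʳ (map _ (transfers x z))
  (∈-++⁺ʳ (map _ (transfers y x)) (∈-++⁺ʳ (map _ (transfers y z))
  (∈-++⁺ʳ (map _ (transfers z x)) (∈-map⁺ _ (∈-transfers⁺ t))))))

transfer-decreases : ∀ {s r s′ r′} → Transfer s r s′ r′ → s′ * s′ + r′ * r′ < s * s + r * r
transfer-decreases (transfer r k d) =
  subst (after <_) (sym (gain r (suc k) d)) (m<m+n after (s≤s z≤n))
  where
  after : ℕ
  after = (r + suc k + d) * (r + suc k + d) + (r + suc k) * (r + suc k)
  gain : ∀ r k d → (r + k + d + k) * (r + k + d + k) + r * r
                 ≡ (r + k + d) * (r + k + d) + (r + k) * (r + k) + 2 * k * (k + d)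
  gain = solve-∀

+-swap-< : ∀ a b c d → a + b < c + d → b + a < d + c
+-swap-< a b c d = subst₂ _<_ (+-comm a b) (+-comm c d)

+-insert-< : ∀ b a c a′ c′ → a + c < a′ + c′ → a + b + c < a′ + b + c′
+-insert-< b a c a′ c′ =
  subst₂ _<_ (xy∙z≈xz∙y a c b) (xy∙z≈xz∙y a′ c′ b) ∘ +-monoˡ-< b

+-prepend-< : ∀ a b c b′ c′ → b + c < b′ + c′ → a + b + c < a + b′ + c′
+-prepend-< a b c b′ c′ =
  subst₂ _<_ (sym (+-assoc a b c)) (sym (+-assoc a b′ c′)) ∘ +-monoʳ-< a

move-decreases : ∀ {p q} → Move p q → measure q < measure p
move-decreases {x , y , z} {x′ , y′ , z′} (x→y t) =
  +-monoˡ-< (z * z) (transfer-decreases t)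
move-decreases {x , y , z} {x′ , y′ , z′} (y→x t) =
  +-monoˡ-< (z * z) (+-swap-< (y′ * y′) (x′ * x′) (y * y) (x * x) (transfer-decreases t))
move-decreases {x , y , z} {x′ , y′ , z′} (x→z t) =
  +-insert-< (y * y) (x′ * x′) (z′ * z′) (x * x) (z * z) (transfer-decreases t)
move-decreases {x , y , z} {x′ , y′ , z′} (z→x t) =
  +-insert-< (y * y) (x′ * x′) (z′ * z′) (x * x) (z * z)
    (+-swap-< (z′ * z′) (x′ * x′) (z * z) (x * x) (transfer-decreases t))
move-decreases {x , y , z} {x′ , y′ , z′} (y→z t) =
  +-prepend-< (x * x) (y′ * y′) (z′ * z′) (y * y) (z * z) (transfer-decreases t)
move-decreases {x , y , z} {x′ , y′ , z′} (z→y t) =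
  +-prepend-< (x * x) (y′ * y′) (z′ * z′) (y * y) (z * z)
    (+-swap-< (z′ * z′) (y′ * y′) (z * z) (y * y) (transfer-decreases t))

grundyFuel-stable : ∀ f g p → measure p < f → measure p < g → grundyFuel f p ≡ grundyFuel g p
grundyFuel-stable (suc f) (suc g) p p<f p<g =
  cong mex (map-cong-local (All.tabulate λ {q} q∈ →
    let q<p = move-decreases (∈-moves⁻ {p} q∈) in
    grundyFuel-stable f g q (<-≤-trans q<p (≤-pred p<f)) (<-≤-trans q<p (≤-pred p<g))))

G≡grundyFuel : ∀ f p → measure p < f → G p ≡ grundyFuel f p
G≡grundyFuel f p = grundyFuel-stable (suc (measure p)) f p ≤-refl

_⊇<_ : List ℕ → ℕ → Set
l ⊇< n = ∀ {j} → j < n → j ∈ l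

⊇<-suc : ∀ {l n} → l ⊇< n → n ∈ l → l ⊇< suc n
⊇<-suc l⊇<n n∈l j<1+n with m≤n⇒m<n∨m≡n (≤-pred j<1+n)
... | inj₁ j<n  = l⊇<n j<n
... | inj₂ refl = n∈l

⊇<⇒≤length : ∀ {l} n → l ⊇< n → n ≤ length l
⊇<⇒≤length zero    _     = z≤n
⊇<⇒≤length (suc n) l⊇<1+n with ys , zs , refl ← ∈-∃++ (l⊇<1+n ≤-refl) =
  subst (suc n ≤_) (sym (trans (length-++ ys) (+-suc (length ys) (length zs))))
    (s≤s (subst (n ≤_) (length-++ ys) (⊇<⇒≤length n ys++zs⊇<n)))
  where
  ys++zs⊇<n : (ys ++ zs) ⊇< n
  ys++zs⊇<n {j} j<n with ∈-++⁻ ys (l⊇<1+n (m<n⇒m<1+n j<n))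
  ... | inj₁ j∈ys         = ∈-++⁺ˡ j∈ys
  ... | inj₂ (here refl)  = ⊥-elim (<-irrefl refl j<n)
  ... | inj₂ (there j∈zs) = ∈-++⁺ʳ ys j∈zs

mexFrom-⊇< : ∀ f i l → l ⊇< i → l ⊇< mexFrom f i l
mexFrom-⊇< zero    i l l⊇<i = l⊇<i
mexFrom-⊇< (suc f) i l l⊇<i with i ∈? l
... | yes i∈l = mexFrom-⊇< f (suc i) l (⊇<-suc l⊇<i i∈l)
... | no  _   = l⊇<i

mexFrom-∉⊎⊇< : ∀ f i l → l ⊇< i → mexFrom f i l ∉ l ⊎ l ⊇< (i + f)
mexFrom-∉⊎⊇< zero    i l l⊇<i = inj₂ (subst (l ⊇<_) (sym (+-identityʳ i)) l⊇<i)
mexFrom-∉⊎⊇< (suc f) i l l⊇<i with i ∈? l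
... | no  i∉l = inj₁ i∉l
... | yes i∈l with mexFrom-∉⊎⊇< f (suc i) l (⊇<-suc l⊇<i i∈l)
...   | inj₁ ∉l = inj₁ ∉l
...   | inj₂ l⊇<1+i+f = inj₂ (subst (l ⊇<_) (sym (+-suc i f)) l⊇<1+i+f)

mex-⊇< : ∀ l → l ⊇< mex l
mex-⊇< l = mexFrom-⊇< (suc (length l)) 0 l (λ ())

-- The fuel suc (length l) of mex never runs out, as l cannot contain all of 0 … length l.
mex-∉ : ∀ l → mex l ∉ l
mex-∉ l with mexFrom-∉⊎⊇< (suc (length l)) 0 l (λ ())
... | inj₁ mex∉l = mex∉l
... | inj₂ l⊇<1+length = ⊥-elim (<-irrefl refl (⊇<⇒≤length (suc (length l)) l⊇<1+length))

mex-cong : ∀ {l₁ l₂} → l₁ ⊆ l₂ → l₂ ⊆ l₁ → mex l₁ ≡ mex l₂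
mex-cong {l₁} {l₂} l₁⊆l₂ l₂⊆l₁ with <-cmp (mex l₁) (mex l₂)
... | tri< lt _ _ = ⊥-elim (mex-∉ l₁ (l₂⊆l₁ (mex-⊇< l₂ lt)))
... | tri≈ _ eq _ = eq
... | tri> _ _ gt = ⊥-elim (mex-∉ l₂ (l₁⊆l₂ (mex-⊇< l₁ gt)))

module _ {B : Pos → Set} {φ : Pos → Pos}
         (move-closed : ∀ {p q} → B p → Move p q → B q)
         (φ-closed : ∀ {p} → B p → B (φ p))
         (φ-involutive : ∀ {p} → B p → φ (φ p) ≡ p)
         (φ-move : ∀ {p q} → B p → Move p q → Move (φ p) (φ q))
         where

  grundyFuel-involution : ∀ f {p} → B p → grundyFuel f (φ p) ≡ grundyFuel f p
  grundyFuel-involution zero    _  = refl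
  grundyFuel-involution (suc f) {p} Bp = mex-cong from-φp to-φp
    where
    to-φp : map (grundyFuel f) (moves p) ⊆ map (grundyFuel f) (moves (φ p))
    to-φp v∈ with q , q∈ , refl ← ∈-map⁻ (grundyFuel f) v∈ =
      subst (_∈ map (grundyFuel f) (moves (φ p)))
        (grundyFuel-involution f (move-closed Bp p→q))
        (∈-map⁺ (grundyFuel f) (∈-moves⁺ (φ-move Bp p→q)))
      where
      p→q : Move p q
      p→q = ∈-moves⁻ q∈
    from-φp : map (grundyFuel f) (moves (φ p)) ⊆ map (grundyFuel f) (moves p)
    from-φp v∈ with q , q∈ , refl ← ∈-map⁻ (grundyFuel f) v∈ =
      subst (_∈ map (grundyFuel f) (moves p))
        (grundyFuel-involution f (move-closed (φ-closed Bp) φp→q))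
        (∈-map⁺ (grundyFuel f) (∈-moves⁺ p→φq))
      where
      φp→q : Move (φ p) q
      φp→q = ∈-moves⁻ q∈
      p→φq : Move p (φ q)
      p→φq = subst (λ p′ → Move p′ (φ q)) (φ-involutive Bp) (φ-move (φ-closed Bp) φp→q)

Bounded : ℕ → Pos → Set
Bounded M (x , y , z) = x ≤ M × y ≤ M × z ≤ M

complement : ℕ → Pos → Pos
complement M (x , y , z) = (M ∸ z , M ∸ y , M ∸ x)

n+o≡m⇒m∸n≡o : ∀ m n o → n + o ≡ m → m ∸ n ≡ o
n+o≡m⇒m∸n≡o .(n + o) n o refl = m+n∸m≡n n o

transfer-complement : ∀ {M s r s′ r′} → Transfer s r s′ r′ → s ≤ M →
                      Transfer (M ∸ r) (M ∸ s) (M ∸ r′) (M ∸ s′)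
transfer-complement (transfer r k d) s≤M = from-gap (m≤n⇒∃[o]m+o≡n s≤M)
  where
  K : ℕ
  K = suc k
  from-gap : ∀ {M} → ∃ (λ e → r + K + d + K + e ≡ M) →
             Transfer (M ∸ r) (M ∸ (r + K + d + K)) (M ∸ (r + K)) (M ∸ (r + K + d))
  from-gap (e , refl)
    rewrite n+o≡m⇒m∸n≡o (r + K + d + K + e) r (e + K + d + K) (solve (r ∷ k ∷ d ∷ e ∷ []))
          | m+n∸m≡n (r + K + d + K) e
          | n+o≡m⇒m∸n≡o (r + K + d + K + e) (r + K) (e + K + d) (solve (r ∷ k ∷ d ∷ e ∷ []))
          | n+o≡m⇒m∸n≡o (r + K + d + K + e) (r + K + d) (e + K) (solve (r ∷ k ∷ d ∷ e ∷ []))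
    = transfer e k d

transfer-bounded : ∀ {M s r s′ r′} → Transfer s r s′ r′ → s ≤ M → s′ ≤ M × r′ ≤ M
transfer-bounded (transfer r k d) s≤M =
  ≤-trans (m≤m+n _ (suc k)) s≤M ,
  ≤-trans (m≤m+n (r + suc k) d) (≤-trans (m≤m+n _ (suc k)) s≤M)

move-bounded : ∀ {M p q} → Bounded M p → Move p q → Bounded M q
move-bounded (x≤M , y≤M , z≤M) (x→y t) =
  let x′≤M , y′≤M = transfer-bounded t x≤M in x′≤M , y′≤M , z≤M
move-bounded (x≤M , y≤M , z≤M) (x→z t) =
  let x′≤M , z′≤M = transfer-bounded t x≤M in x′≤M , y≤M , z′≤M
move-bounded (x≤M , y≤M , z≤M) (y→x t) =
  let y′≤M , x′≤M = transfer-bounded t y≤M in x′≤M , y′≤M , z≤M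
move-bounded (x≤M , y≤M , z≤M) (y→z t) =
  let y′≤M , z′≤M = transfer-bounded t y≤M in x≤M , y′≤M , z′≤M
move-bounded (x≤M , y≤M , z≤M) (z→x t) =
  let z′≤M , x′≤M = transfer-bounded t z≤M in x′≤M , y≤M , z′≤M
move-bounded (x≤M , y≤M , z≤M) (z→y t) =
  let z′≤M , y′≤M = transfer-bounded t z≤M in x≤M , y′≤M , z′≤M

complement-bounded : ∀ M p → Bounded M (complement M p)
complement-bounded M (x , y , z) = m∸n≤m M z , m∸n≤m M y , m∸n≤m M x

complement-involutive : ∀ {M p} → Bounded M p → complement M (complement M p) ≡ p
complement-involutive (x≤M , y≤M , z≤M) =
  cong₂ _,_ (m∸[m∸n]≡n x≤M) (cong₂ _,_ (m∸[m∸n]≡n y≤M) (m∸[m∸n]≡n z≤M))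

move-complement : ∀ {M p q} → Bounded M p → Move p q → Move (complement M p) (complement M q)
move-complement (x≤M , y≤M , z≤M) (x→y t) = y→z (transfer-complement t x≤M)
move-complement (x≤M , y≤M , z≤M) (x→z t) = x→z (transfer-complement t x≤M)
move-complement (x≤M , y≤M , z≤M) (y→x t) = z→y (transfer-complement t y≤M)
move-complement (x≤M , y≤M , z≤M) (y→z t) = x→y (transfer-complement t y≤M)
move-complement (x≤M , y≤M , z≤M) (z→x t) = z→x (transfer-complement t z≤M)
move-complement (x≤M , y≤M , z≤M) (z→y t) = y→x (transfer-complement t z≤M)

grundyFuel-complement : ∀ f {M p} → Bounded M p → grundyFuel f (complement M p) ≡ grundyFuel f p
grundyFuel-complement f {M} =
  grundyFuel-involution move-bounded (λ {p} _ → complement-bounded M p)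
    complement-involutive move-complement f

mainTheorem2 : (a b : ℕ) → a ≤ b → G (0 , a , b) ≡ G (0 , b ∸ a , b)
mainTheorem2 a b a≤b = begin
  G (0 , a , b)                     ≡⟨ G≡grundyFuel F p p<F ⟩
  grundyFuel F (0 , a , b)          ≡⟨ grundyFuel-complement F (z≤n , a≤b , ≤-refl) ⟨
  grundyFuel F (b ∸ b , b ∸ a , b)  ≡⟨ cong (λ x → grundyFuel F (x , b ∸ a , b)) (n∸n≡0 b) ⟩
  grundyFuel F (0 , b ∸ a , b)      ≡⟨ G≡grundyFuel F q q<F ⟨
  G (0 , b ∸ a , b)                 ∎
  where
  open ≡-Reasoning
  p q : Pos
  p = (0 , a , b)
  q = (0 , b ∸ a , b)
  F : ℕ
  F = suc (measure p + measure q)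
  p<F : measure p < F
  p<F = s≤s (m≤m+n (measure p) (measure q))
  q<F : measure q < F
  q<F = s≤s (m≤n+m (measure q) (measure p))
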